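{- Let $d,b\in\mathbb N$, $G=(V,E)$ a graph and $V_1,V_2,B\subseteq V$ such that $(G,V_1,V_2,B)$ is a $(d,b)$-bridge. Then for every graph $H$: $G$ contains an induced subgraph isomorphic to $H$ if and only if $\mathcal D(G,V_1,V_2,B,d)\models\mathit{induced}^2_{b,H}$.
   Context: Graphs are simple, finite, with nonempty vertex set. $H=(W,F)$ is $d$-degree-extreme if each $v\in W$ has $\deg(v)\le d$ or $\deg(v)\ge|W|-1-d$; $V^H_{\le d}:=\{v:\deg^H(v)\le d\}$. $\mathcal A(H,d)$ is the $\{P,R\}$-structure with universe $W$, $P:=V^H_{\le d}$, $R:=\{(u,v):\{u,v\}\in F,\ u\in V^H_{\le d}\text{ or }v\in V^H_{\le d}\}\cup\{(u,v):\{u,v\}\notin F,\ u,v\notin V^H_{\le d},\ u\ne v\}$. $(G,V_1,V_2,B)$ is a $(d,b)$-bridge if $V=V_1\cup V_2$ disjointly, $G[V_1],G[V_2]$ are $d$-degree-extreme, $|B|=b$, and every edge between $V_1$ and $V_2$ has an endpoint in $B$. Writing $B=\{v_1,\dots,v_b\}$, $\mathcal D(G,V_1,V_2,B,d)$ is the structure over $\{U_1,U_2,P,R,F_1,\dots,F_b,C_1,\dots,C_b\}$ (all unary except binary $R$) whose $\{P,R\}$-part is the disjoint union of $\mathcal A(G[V_1],d)$ and $\mathcal A(G[V_2],d)$, with $U_1:=V_1$, $U_2:=V_2$, $F_i:=\{v_i\}$, $C_i:=\{u\in V:\{u,v_i\}\in E\}$. Let $\mathit{edge}(x,y):=(Rxy\wedge(Px\vee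 Py))\vee(\neg Rxy\wedge\neg Px\wedge\neg Py)$ and $\mathit{edge}^2_b(x,y):=(U_1x\wedge U_1y\wedge\mathit{edge}(x,y))\vee(U_2x\wedge U_2y\wedge\mathit{edge}(x,y))\vee\bigvee_{i\in[b]}((F_ix\wedge C_iy)\vee(F_iy\wedge C_ix))$. For a graph $H$ with vertex set $[\ell]$ and edge set $E_H$, $\mathit{induced}^2_{b,H}:=\exists x_1\dots\exists x_\ell\big(\bigwedge_{1\le i<j\le\ell}\neg x_i=x_j\wedge\bigwedge_{\{i,j\}\in E_H}\mathit{edge}^2_b(x_i,x_j)\wedge\bigwedge_{\{i,j\}\in\binom{[\ell]}{2}\setminus E_H}\neg\mathit{edge}^2_b(x_i,x_j)\big)$. -}

module Defs where

open import Data.Nat using (ℕ; zero; suc; _≤_; _<_; _∸_; _≡ᵇ_)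
open import Data.Bool using (Bool; true; false; if_then_else_)
open import Data.Fin using (Fin; toℕ)
open import Data.Fin.Subset using (Subset; _∈_; _∉_; _∩_; ∣_∣)
open import Data.Vec using (tabulate)
open import Data.Product using (Σ; _×_; ∃)
open import Data.Sum using (_⊎_)
open import Data.Empty using (⊥)
open import Data.Unit using (⊤)
open import Relation.Nullary using (¬_)
open import Relation.Binary.PropositionalEquality using (_≡_; _≢_)
open import Function.Definitions using (Injective)

record Graph : Set where
  field
    n        : ℕ
    adj      : Fin n → Fin n → Bool
    sym      : ∀ u v → adj u v ≡ adj v u
    irrefl   : ∀ v → adj v v ≡ false
    nonempty : 0 < n
open Graph public

Edge : (G : Graph) → Fin (n G) → Fin (n G) → Set
Edge G u v = adj G u v ≡ true

nbhd : (G : Graph) → Fin (n G) → Subset (n G)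
nbhd G v = tabulate (adj G v)

deg : (G : Graph) → Subset (n G) → Fin (n G) → ℕ
deg G S v = ∣ S ∩ nbhd G v ∣

DegreeExtreme : (G : Graph) → Subset (n G) → ℕ → Set
DegreeExtreme G S d =
  ∀ v → v ∈ S → (deg G S v ≤ d) ⊎ (∣ S ∣ ∸ 1 ∸ d ≤ deg G S v)

InB : (G : Graph) {b : ℕ} → (Fin b → Fin (n G)) → Fin (n G) → Set
InB G enum v = ∃ λ i → enum i ≡ v

-- (G, V₁, V₂, B) is a (d,b)-bridge, with B given by an injective
-- enumeration  enum : Fin b → V  (so |B| = b and B = {v₁,…,v_b}).
record IsBridge (d b : ℕ) (G : Graph) (V₁ V₂ : Subset (n G))
                (enum : Fin b → Fin (n G)) : Set where
  field
    cover    : ∀ v → v ∈ V₁ ⊎ v ∈ V₂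
    disjoint : ∀ v → v ∈ V₁ → v ∉ V₂
    extreme₁ : DegreeExtreme G V₁ d
    extreme₂ : DegreeExtreme G V₂ d
    enumInj  : Injective _≡_ _≡_ enum
    crossing : ∀ u v → u ∈ V₁ → v ∈ V₂ → Edge G u v →
               InB G enum u ⊎ InB G enum v

-- The structure 𝒜(G[S], d) (universe S ⊆ V(G))

𝒜P : (G : Graph) → Subset (n G) → ℕ → Fin (n G) → Set
𝒜P G S d v = v ∈ S × deg G S v ≤ d

𝒜R : (G : Graph) → Subset (n G) → ℕ → Fin (n G) → Fin (n G) → Set
𝒜R G S d u v =
  u ∈ S × v ∈ S ×
  ( (Edge G u v × (𝒜P G S d u ⊎ 𝒜P G S d v))
  ⊎ (¬ Edge G u v × ¬ 𝒜P G S d u × ¬ 𝒜P G S d v × u ≢ v))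

data UnarySym (b : ℕ) : Set where
  U₁ U₂ P : UnarySym b
  F C     : Fin b → UnarySym b

Var : Set
Var = ℕ

infix  6 ¬'_
infixr 5 _∧'_
infixr 4 _∨'_
infix  7 _≐_

data Formula (b : ℕ) : Set where
  ⊤'   : Formula b
  ⊥'   : Formula b
  un   : UnarySym b → Var → Formula b
  R'   : Var → Var → Formula b
  _≐_  : Var → Var → Formula b
  ¬'_  : Formula b → Formula b
  _∧'_ : Formula b → Formula b → Formula b
  _∨'_ : Formula b → Formula b → Formula b
  ∃'   : Var → Formula b → Formula b

record Structure (b : ℕ) : Set₁ where
  field
    m     : ℕ
    unRel : UnarySym b → Fin m → Set
    R     : Fin m → Fin m → Set
open Structure public

update : {m : ℕ} → (Var → Fin m) → Var → Fin m → (Var → Fin m)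
update s x a y = if y ≡ᵇ x then a else s y

Sat : {b : ℕ} (𝔄 : Structure b) → Formula b → (Var → Fin (m 𝔄)) → Set
Sat 𝔄 ⊤'         s = ⊤
Sat 𝔄 ⊥'         s = ⊥
Sat 𝔄 (un Q x)   s = unRel 𝔄 Q (s x)
Sat 𝔄 (R' x y)   s = R 𝔄 (s x) (s y)
Sat 𝔄 (x ≐ y)    s = s x ≡ s y
Sat 𝔄 (¬' φ)     s = ¬ Sat 𝔄 φ s
Sat 𝔄 (φ ∧' ψ)   s = Sat 𝔄 φ s × Sat 𝔄 ψ s
Sat 𝔄 (φ ∨' ψ)   s = Sat 𝔄 φ s ⊎ Sat 𝔄 ψ s
Sat 𝔄 (∃' x φ)   s = Σ (Fin (m 𝔄)) λ a → Sat 𝔄 φ (update s x a)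

_⊨_ : {b : ℕ} (𝔄 : Structure b) → Formula b → Set
𝔄 ⊨ φ = ∀ s → Sat 𝔄 φ s

-- The structure 𝒟(G, V₁, V₂, B, d); universe V = Fin (n G);
-- its {P,R}-part is the disjoint union of 𝒜(G[V₁],d) and 𝒜(G[V₂],d).

𝒟 : (G : Graph) (V₁ V₂ : Subset (n G)) {b : ℕ} (enum : Fin b → Fin (n G))
    (d : ℕ) → Structure b
𝒟 G V₁ V₂ {b} enum d = record { m = n G ; unRel = I ; R = Rel }
  where
  I : UnarySym b → Fin (n G) → Set
  I U₁    v = v ∈ V₁
  I U₂    v = v ∈ V₂
  I P     v = 𝒜P G V₁ d v ⊎ 𝒜P G V₂ d v
  I (F i) v = v ≡ enum i
  I (C i) v = Edge G v (enum i)
  Rel : Fin (n G) → Fin (n G) → Set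
  Rel u v = 𝒜R G V₁ d u v ⊎ 𝒜R G V₂ d u v

⋀Fin : {b : ℕ} (k : ℕ) → (Fin k → Formula b) → Formula b
⋀Fin zero    f = ⊤'
⋀Fin (suc k) f = f Fin.zero ∧' ⋀Fin k (λ i → f (Fin.suc i))
  where import Data.Fin as Fin

⋁Fin : {b : ℕ} (k : ℕ) → (Fin k → Formula b) → Formula b
⋁Fin zero    f = ⊥'
⋁Fin (suc k) f = f Fin.zero ∨' ⋁Fin k (λ i → f (Fin.suc i))
  where import Data.Fin as Fin

edge : {b : ℕ} → Var → Var → Formula b
edge x y = (R' x y ∧' (un P x ∨' un P y))
        ∨' (¬' R' x y ∧' (¬' un P x ∧' ¬' un P y))

edge² : (b : ℕ) → Var → Var → Formula b
edge² b x y =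
  ((un U₁ x ∧' (un U₁ y ∧' edge x y)) ∨' (un U₂ x ∧' (un U₂ y ∧' edge x y)))
  ∨' ⋁Fin b (λ i → (un (F i) x ∧' un (C i) y) ∨' (un (F i) y ∧' un (C i) x))

-- ∃x₀ ∃x₁ … ∃x_{k-1} φ   (variable xᵢ is the natural number i)
∃Prefix : {b : ℕ} → ℕ → Formula b → Formula b
∃Prefix zero    φ = φ
∃Prefix (suc k) φ = ∃Prefix k (∃' k φ)

induced² : (b : ℕ) (H : Graph) → Formula b
induced² b H = ∃Prefix (n H) (⋀Fin (n H) λ i → ⋀Fin (n H) λ j →
  pairClause (toℕ i <ᵇ toℕ j) (adj H i j) (toℕ i) (toℕ j))
  where
  open import Data.Nat using (_<ᵇ_)
  pairClause : Bool → Bool → Var → Var → Formula b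
  pairClause false _     x y = ⊤'
  pairClause true  true  x y = (¬' (x ≐ y)) ∧' edge² b x y
  pairClause true  false x y = (¬' (x ≐ y)) ∧' (¬' edge² b x y)

ContainsInduced : Graph → Graph → Set
ContainsInduced G H =
  Σ (Fin (n H) → Fin (n G)) λ f →
    Injective _≡_ _≡_ f × (∀ i j → adj G (f i) (f j) ≡ adj H i j)

-- The formula edge²_b defines the edge relation of G in 𝒟 on distinct
-- elements: inside V₁ or V₂ the pair (P, R) is the edge relation with the
-- edges among high-degree vertices complemented, and every edge between V₁
-- and V₂ meets B, where F_i and C_i record the neighbourhood of v_i. Hence
-- induced²_{b,H}, which asks for ℓ distinct elements pairwise related by
-- edge² exactly as prescribed by H, holds iff G has an induced copy of H.

module Submission where

open import Defs hiding (sym)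
open import Data.Bool using (Bool; true; false; T)
open import Data.Bool.Properties using (¬-not)
open import Data.Empty using (⊥-elim)
open import Data.Fin using (Fin; zero; suc; toℕ; fromℕ<) renaming (_<_ to _<ᶠ_)
open import Data.Fin.Properties using (<-cmp; fromℕ<-toℕ; toℕ<n)
open import Data.Fin.Subset using (Subset; _∈_)
open import Data.Fin.Subset.Properties using (_∈?_)
open import Data.Nat using (ℕ; zero; suc; _≤_; z≤n; _≡ᵇ_; _<ᵇ_; _≟_; _≤?_; _<?_)
open import Data.Nat.Properties using (≡ᵇ⇒≡; ≡⇒≡ᵇ; ≤∧≢⇒<; <ᵇ⇒<; <⇒<ᵇ; <-irrefl; <⇒≱)
open import Data.Product using (Σ; ∃; _×_; _,_; proj₁; proj₂; uncurry)
open import Data.Product.Function.NonDependent.Propositional using (_×-⇔_)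
open import Data.Sum using (_⊎_; inj₁; inj₂; [_,_]; fromInj₁; fromInj₂; swap)
open import Data.Sum.Function.Propositional using (_⊎-⇔_)
open import Data.Unit using (tt)
open import Function using (_∘_; case_of_)
open import Function.Bundles using (_⇔_; mk⇔; Equivalence)
open import Function.Definitions using (Injective)
open import Function.Properties.Equivalence using () renaming (trans to ⇔-trans)
open import Function.Related.TypeIsomorphisms using (¬-cong-⇔)
open import Relation.Binary using (tri<; tri≈; tri>)
open import Relation.Binary.PropositionalEquality
  using (_≡_; _≢_; refl; sym; trans; cong; cong₂; subst; subst₂)
open import Relation.Nullary using (¬_; Dec; yes; no; contradiction)
open import Relation.Nullary.Decidable using (_×-dec_)

open Equivalence using (to; from)

update-self : ∀ {k} (s : Var → Fin k) x a → update s x a x ≡ a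
update-self s x a with x ≡ᵇ x in e
... | true  = refl
... | false = ⊥-elim (subst T e (≡⇒≡ᵇ x x refl))

update-other : ∀ {k} (s : Var → Fin k) {x y} a → y ≢ x → update s x a y ≡ s y
update-other s {x} {y} a y≢x with y ≡ᵇ x in e
... | true  = ⊥-elim (y≢x (≡ᵇ⇒≡ y x (subst T (sym e) tt)))
... | false = refl

update-cong : ∀ {k} {s t : Var → Fin k} x a → (∀ y → s y ≡ t y) →
              ∀ y → update s x a y ≡ update t x a y
update-cong x a s≗t y with y ≡ᵇ x
... | true  = refl
... | false = s≗t y

module _ {b : ℕ} (𝔄 : Structure b) where

  Sat-cong : ∀ φ {s t : Var → Fin (m 𝔄)} → (∀ y → s y ≡ t y) → Sat 𝔄 φ s → Sat 𝔄 φ t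
  Sat-cong ⊤'       s≗t sat = sat
  Sat-cong ⊥'       s≗t sat = sat
  Sat-cong (un Q x) s≗t sat = subst (unRel 𝔄 Q) (s≗t x) sat
  Sat-cong (R' x y) s≗t sat = subst₂ (R 𝔄) (s≗t x) (s≗t y) sat
  Sat-cong (x ≐ y)  s≗t sat = trans (sym (s≗t x)) (trans sat (s≗t y))
  Sat-cong (¬' φ)   s≗t sat = sat ∘ Sat-cong φ (sym ∘ s≗t)
  Sat-cong (φ ∧' ψ) s≗t (sat₁ , sat₂) = Sat-cong φ s≗t sat₁ , Sat-cong ψ s≗t sat₂
  Sat-cong (φ ∨' ψ) s≗t (inj₁ sat) = inj₁ (Sat-cong φ s≗t sat)
  Sat-cong (φ ∨' ψ) s≗t (inj₂ sat) = inj₂ (Sat-cong ψ s≗t sat)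
  Sat-cong (∃' x φ) s≗t (a , sat) = a , Sat-cong φ (update-cong x a s≗t) sat

  Sat-⋀Fin⁺ : ∀ k f s → (∀ i → Sat 𝔄 (f i) s) → Sat 𝔄 (⋀Fin k f) s
  Sat-⋀Fin⁺ zero    f s sat = tt
  Sat-⋀Fin⁺ (suc k) f s sat = sat zero , Sat-⋀Fin⁺ k (f ∘ suc) s (sat ∘ suc)

  Sat-⋀Fin⁻ : ∀ k f s → Sat 𝔄 (⋀Fin k f) s → ∀ i → Sat 𝔄 (f i) s
  Sat-⋀Fin⁻ (suc k) f s (sat , _)   zero    = sat
  Sat-⋀Fin⁻ (suc k) f s (_   , sat) (suc i) = Sat-⋀Fin⁻ k (f ∘ suc) s sat i

  Sat-⋁Fin⁺ : ∀ k f s i → Sat 𝔄 (f i) s → Sat 𝔄 (⋁Fin k f) s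
  Sat-⋁Fin⁺ (suc k) f s zero    sat = inj₁ sat
  Sat-⋁Fin⁺ (suc k) f s (suc i) sat = inj₂ (Sat-⋁Fin⁺ k (f ∘ suc) s i sat)

  Sat-⋁Fin⁻ : ∀ k f s → Sat 𝔄 (⋁Fin k f) s → ∃ λ i → Sat 𝔄 (f i) s
  Sat-⋁Fin⁻ (suc k) f s (inj₁ sat) = zero , sat
  Sat-⋁Fin⁻ (suc k) f s (inj₂ sat) with Sat-⋁Fin⁻ k (f ∘ suc) s sat
  ... | i , sat-i = suc i , sat-i

  Sat-∃Prefix⁺ : ∀ k φ s t → (∀ y → k ≤ y → t y ≡ s y) → Sat 𝔄 φ t →
                 Sat 𝔄 (∃Prefix k φ) s
  Sat-∃Prefix⁺ zero    φ s t agree sat = Sat-cong φ (λ y → agree y z≤n) sat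
  Sat-∃Prefix⁺ (suc k) φ s t agree sat =
    Sat-∃Prefix⁺ k (∃' k φ) s t′ agree′ (t k , Sat-cong φ restore sat)
    where
    t′ : Var → Fin (m 𝔄)
    t′ = update t k (s k)
    agree′ : ∀ y → k ≤ y → t′ y ≡ s y
    agree′ y k≤y with y ≟ k
    ... | yes refl = update-self t k (s k)
    ... | no  y≢k  = trans (update-other t (s k) y≢k) (agree y (≤∧≢⇒< k≤y (y≢k ∘ sym)))
    restore : ∀ y → t y ≡ update t′ k (t k) y
    restore y with y ≟ k
    ... | yes refl = sym (update-self t′ k (t k))
    ... | no  y≢k  = sym (trans (update-other t′ (t k) y≢k) (update-other t (s k) y≢k))

  Sat-∃Prefix⁻ : ∀ k φ s → Sat 𝔄 (∃Prefix k φ) s → ∃ λ t → Sat 𝔄 φ t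
  Sat-∃Prefix⁻ zero    φ s sat = s , sat
  Sat-∃Prefix⁻ (suc k) φ s sat with Sat-∃Prefix⁻ k (∃' k φ) s sat
  ... | t , (a , sat-a) = update t k a , sat-a

Edge-sym : (G : Graph) → ∀ {u v} → Edge G u v → Edge G v u
Edge-sym G {u} {v} e = trans (Graph.sym G v u) e

Edge-irrefl : (G : Graph) → ∀ {u v} → Edge G u v → u ≢ v
Edge-irrefl G {u} e refl with trans (sym e) (irrefl G u)
... | ()

Edge? : (G : Graph) → ∀ u v → Dec (Edge G u v)
Edge? G u v with adj G u v
... | true  = yes refl
... | false = no λ ()

¬⇒⊎-identityʳ : ∀ {A B : Set} → ¬ B → (A ⊎ B) ⇔ A
¬⇒⊎-identityʳ ¬B = mk⇔ (fromInj₁ (⊥-elim ∘ ¬B)) inj₁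

¬⇒⊎-identityˡ : ∀ {A B : Set} → ¬ A → (A ⊎ B) ⇔ B
¬⇒⊎-identityˡ ¬A = mk⇔ (fromInj₂ (⊥-elim ∘ ¬A)) inj₂

-- Sat 𝔄 (edge x y) s is definitionally EdgeCode (unRel 𝔄 P) (R 𝔄) (s x) (s y).
EdgeCode : {A : Set} → (A → Set) → (A → A → Set) → A → A → Set
EdgeCode Pr Rel u v = (Rel u v × (Pr u ⊎ Pr v)) ⊎ (¬ Rel u v × (¬ Pr u × ¬ Pr v))

EdgeCode-cong : ∀ {A : Set} {Pr Pr′ : A → Set} {Rel Rel′ : A → A → Set} {u v} →
                Pr u ⇔ Pr′ u → Pr v ⇔ Pr′ v → Rel u v ⇔ Rel′ u v →
                EdgeCode Pr Rel u v ⇔ EdgeCode Pr′ Rel′ u v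
EdgeCode-cong Pu Pv Ruv =
  (Ruv ×-⇔ (Pu ⊎-⇔ Pv)) ⊎-⇔ (¬-cong-⇔ Ruv ×-⇔ (¬-cong-⇔ Pu ×-⇔ ¬-cong-⇔ Pv))

module _ (G : Graph) (S : Subset (n G)) (d : ℕ) where

  𝒜P? : ∀ u → Dec (𝒜P G S d u)
  𝒜P? u = (u ∈? S) ×-dec (deg G S u ≤? d)

  𝒜-decodes-Edge : ∀ {u v} → u ∈ S → v ∈ S → u ≢ v →
                   EdgeCode (𝒜P G S d) (𝒜R G S d) u v ⇔ Edge G u v
  𝒜-decodes-Edge {u} {v} u∈S v∈S u≢v = mk⇔ decode encode
    where
    decode : EdgeCode (𝒜P G S d) (𝒜R G S d) u v → Edge G u v
    decode (inj₁ ((_ , _ , inj₁ (e , _)) , _)) = e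
    decode (inj₁ ((_ , _ , inj₂ (_ , ¬Pu , ¬Pv , _)) , Pu⊎Pv)) = ⊥-elim ([ ¬Pu , ¬Pv ] Pu⊎Pv)
    decode (inj₂ (¬Ruv , ¬Pu , ¬Pv)) with Edge? G u v
    ... | yes e  = e
    ... | no  ¬e = contradiction (u∈S , v∈S , inj₂ (¬e , ¬Pu , ¬Pv , u≢v)) ¬Ruv

    encode : Edge G u v → EdgeCode (𝒜P G S d) (𝒜R G S d) u v
    encode e with 𝒜P? u | 𝒜P? v
    ... | yes Pu  | _        = inj₁ ((u∈S , v∈S , inj₁ (e , inj₁ Pu)) , inj₁ Pu)
    ... | no  _   | yes Pv   = inj₁ ((u∈S , v∈S , inj₁ (e , inj₂ Pv)) , inj₂ Pv)
    ... | no  ¬Pu | no  ¬Pv  = inj₂ (¬Ruv , ¬Pu , ¬Pv)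
      where
      ¬Ruv : ¬ 𝒜R G S d u v
      ¬Ruv (_ , _ , inj₁ (_ , Pu⊎Pv)) = [ ¬Pu , ¬Pv ] Pu⊎Pv
      ¬Ruv (_ , _ , inj₂ (¬e , _))    = ¬e e

onVertices : {b : ℕ} (G : Graph) → (UnarySym b → Fin (n G) → Set) →
             (Fin (n G) → Fin (n G) → Set) → Structure b
onVertices G I Rel = record { m = n G ; unRel = I ; R = Rel }

DefinesAdjacency : {b : ℕ} (G : Graph) (I : UnarySym b → Fin (n G) → Set)
                   (Rel : Fin (n G) → Fin (n G) → Set) → (Var → Var → Formula b) → Set
DefinesAdjacency G I Rel ε =
  ∀ {x y} s → s x ≢ s y → Sat (onVertices G I Rel) (ε x y) s ⇔ Edge G (s x) (s y)

module _ {d b : ℕ} {G : Graph} {V₁ V₂ : Subset (n G)} {enum : Fin b → Fin (n G)}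
         (bridge : IsBridge d b G V₁ V₂ enum) where
  open IsBridge bridge

  private
    𝔇 : Structure b
    𝔇 = 𝒟 G V₁ V₂ enum d

  EdgeCode-within₁ : ∀ {u v} → u ∈ V₁ → v ∈ V₁ → u ≢ v →
                     EdgeCode (unRel 𝔇 P) (R 𝔇) u v ⇔ Edge G u v
  EdgeCode-within₁ {u} {v} u∈ v∈ u≢v = ⇔-trans restrict (𝒜-decodes-Edge G V₁ d u∈ v∈ u≢v)
    where
    only₁ : ∀ {w} → w ∈ V₁ → (𝒜P G V₁ d w ⊎ 𝒜P G V₂ d w) ⇔ 𝒜P G V₁ d w
    only₁ {w} w∈ = ¬⇒⊎-identityʳ (λ p → disjoint w w∈ (proj₁ p))
    restrict : EdgeCode (unRel 𝔇 P) (R 𝔇) u v ⇔ EdgeCode (𝒜P G V₁ d) (𝒜R G V₁ d) u v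
    restrict = EdgeCode-cong {Rel = R 𝔇} {Rel′ = 𝒜R G V₁ d} (only₁ u∈) (only₁ v∈) (¬⇒⊎-identityʳ (λ r → disjoint u u∈ (proj₁ r)))

  EdgeCode-within₂ : ∀ {u v} → u ∈ V₂ → v ∈ V₂ → u ≢ v →
                     EdgeCode (unRel 𝔇 P) (R 𝔇) u v ⇔ Edge G u v
  EdgeCode-within₂ {u} {v} u∈ v∈ u≢v = ⇔-trans restrict (𝒜-decodes-Edge G V₂ d u∈ v∈ u≢v)
    where
    only₂ : ∀ {w} → w ∈ V₂ → (𝒜P G V₁ d w ⊎ 𝒜P G V₂ d w) ⇔ 𝒜P G V₂ d w
    only₂ {w} w∈ = ¬⇒⊎-identityˡ (λ p → disjoint w (proj₁ p) w∈)
    restrict : EdgeCode (unRel 𝔇 P) (R 𝔇) u v ⇔ EdgeCode (𝒜P G V₂ d) (𝒜R G V₂ d) u v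
    restrict = EdgeCode-cong {Rel = R 𝔇} {Rel′ = 𝒜R G V₂ d} (only₂ u∈) (only₂ v∈) (¬⇒⊎-identityˡ (λ r → disjoint u (proj₁ r) u∈))

  edge-via-B : ∀ {u v} → Edge G u v → InB G enum u ⊎ InB G enum v →
               ∃ λ i → (u ≡ enum i × Edge G v (enum i)) ⊎ (v ≡ enum i × Edge G u (enum i))
  edge-via-B e (inj₁ (i , refl)) = i , inj₁ (refl , Edge-sym G e)
  edge-via-B e (inj₂ (i , refl)) = i , inj₂ (refl , e)

  edge²-sound : ∀ {x y} s → s x ≢ s y → Sat 𝔇 (edge² b x y) s → Edge G (s x) (s y)
  edge²-sound s ne (inj₁ (inj₁ (x∈ , y∈ , code))) = to (EdgeCode-within₁ x∈ y∈ ne) code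
  edge²-sound s ne (inj₁ (inj₂ (x∈ , y∈ , code))) = to (EdgeCode-within₂ x∈ y∈ ne) code
  edge²-sound {x} {y} s ne (inj₂ sat) with Sat-⋁Fin⁻ 𝔇 b _ s sat
  ... | i , inj₁ (x≡ , e) = Edge-sym G (subst (Edge G (s y)) (sym x≡) e)
  ... | i , inj₂ (y≡ , e) = subst (Edge G (s x)) (sym y≡) e

  edge²-complete : ∀ {x y} s → Edge G (s x) (s y) → Sat 𝔇 (edge² b x y) s
  edge²-complete {x} {y} s e with cover (s x) | cover (s y)
  ... | inj₁ x∈ | inj₁ y∈ = inj₁ (inj₁ (x∈ , y∈ , from (EdgeCode-within₁ x∈ y∈ (Edge-irrefl G e)) e))
  ... | inj₂ x∈ | inj₂ y∈ = inj₁ (inj₂ (x∈ , y∈ , from (EdgeCode-within₂ x∈ y∈ (Edge-irrefl G e)) e))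
  ... | inj₁ x∈ | inj₂ y∈ =
    inj₂ (uncurry (Sat-⋁Fin⁺ 𝔇 b _ s) (edge-via-B e (crossing _ _ x∈ y∈ e)))
  ... | inj₂ x∈ | inj₁ y∈ =
    inj₂ (uncurry (Sat-⋁Fin⁺ 𝔇 b _ s) (edge-via-B e (swap (crossing _ _ y∈ x∈ (Edge-sym G e)))))

  edge²-defines-adjacency : DefinesAdjacency G (unRel 𝔇) (R 𝔇) (edge² b)
  edge²-defines-adjacency s ne = mk⇔ (edge²-sound s ne) (edge²-complete s)

IsInducedEmbedding : (G H : Graph) → (Fin (n H) → Fin (n G)) → Set
IsInducedEmbedding G H f = Injective _≡_ _≡_ f × (∀ i j → adj G (f i) (f j) ≡ adj H i j)

InducedOnIncreasingPairs : (G H : Graph) → (Fin (n H) → Fin (n G)) → Set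
InducedOnIncreasingPairs G H f = ∀ i j → i <ᶠ j → f i ≢ f j × adj G (f i) (f j) ≡ adj H i j

IsInducedEmbedding-cong : ∀ G H {f g : Fin (n H) → Fin (n G)} → (∀ i → f i ≡ g i) →
                          IsInducedEmbedding G H f → IsInducedEmbedding G H g
IsInducedEmbedding-cong G H {f} {g} f≗g (f-inj , f-induced) = g-inj , g-induced
  where
  g-inj : Injective _≡_ _≡_ g
  g-inj {i} {j} gi≡gj = f-inj (trans (f≗g i) (trans gi≡gj (sym (f≗g j))))
  g-induced : ∀ i j → adj G (g i) (g j) ≡ adj H i j
  g-induced i j = subst₂ (λ u v → adj G u v ≡ adj H i j) (f≗g i) (f≗g j) (f-induced i j)

-- Symmetry and irreflexivity of both graphs reduce the other pairs to increasing ones.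
increasing⇔embedding : ∀ G H (f : Fin (n H) → Fin (n G)) →
                       InducedOnIncreasingPairs G H f ⇔ IsInducedEmbedding G H f
increasing⇔embedding G H f = mk⇔ embedding increasing
  where
  embedding : InducedOnIncreasingPairs G H f → IsInducedEmbedding G H f
  embedding ind = f-inj , f-induced
    where
    f-inj : Injective _≡_ _≡_ f
    f-inj {i} {j} fi≡fj with <-cmp i j
    ... | tri< i<j _ _ = contradiction fi≡fj (proj₁ (ind i j i<j))
    ... | tri≈ _ i≡j _ = i≡j
    ... | tri> _ _ j<i = contradiction (sym fi≡fj) (proj₁ (ind j i j<i))
    f-induced : ∀ i j → adj G (f i) (f j) ≡ adj H i j
    f-induced i j with <-cmp i j
    ... | tri< i<j _ _    = proj₂ (ind i j i<j)
    ... | tri≈ _ refl _   = trans (irrefl G (f i)) (sym (irrefl H i))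
    ... | tri> _ _ j<i    =
      trans (Graph.sym G (f i) (f j)) (trans (proj₂ (ind j i j<i)) (Graph.sym H j i))

  increasing : IsInducedEmbedding G H f → InducedOnIncreasingPairs G H f
  increasing (f-inj , f-induced) i j i<j =
    (λ fi≡fj → <-irrefl (cong toℕ (f-inj fi≡fj)) i<j) , f-induced i j

pairClause : {b : ℕ} → (Var → Var → Formula b) → Bool → Bool → Var → Var → Formula b
pairClause ε false _     x y = ⊤'
pairClause ε true  true  x y = ¬' (x ≐ y) ∧' ε x y
pairClause ε true  false x y = ¬' (x ≐ y) ∧' ¬' ε x y

inducedBy : {b : ℕ} → (Var → Var → Formula b) → Graph → Formula b
inducedBy ε H = ∃Prefix (n H) (⋀Fin (n H) λ i → ⋀Fin (n H) λ j →
  pairClause ε (toℕ i <ᵇ toℕ j) (adj H i j) (toℕ i) (toℕ j))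

extend : ∀ {k l} → (Fin k → Fin l) → (Var → Fin l) → Var → Fin l
extend {k} a s y with y <? k
... | yes y<k = a (fromℕ< y<k)
... | no  _   = s y

extend-toℕ : ∀ {k l} (a : Fin k → Fin l) s i → extend a s (toℕ i) ≡ a i
extend-toℕ {k} a s i with toℕ i <? k
... | yes i<k = cong a (fromℕ<-toℕ i i<k)
... | no  i≮k = contradiction (toℕ<n i) i≮k

extend-≥ : ∀ {k l} (a : Fin k → Fin l) s y → k ≤ y → extend a s y ≡ s y
extend-≥ {k} a s y k≤y with y <? k
... | yes y<k = contradiction k≤y (<⇒≱ y<k)
... | no  _   = refl

module _ {b : ℕ} (G : Graph) (I : UnarySym b → Fin (n G) → Set)
         (Rel : Fin (n G) → Fin (n G) → Set) {ε : Var → Var → Formula b}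
         (defines : DefinesAdjacency G I Rel ε) (H : Graph) where

  private
    𝔄 : Structure b
    𝔄 = onVertices G I Rel

  Sat-pairClause : ∀ t i j →
    Sat 𝔄 (pairClause ε (toℕ i <ᵇ toℕ j) (adj H i j) (toℕ i) (toℕ j)) t ⇔
    (i <ᶠ j → t (toℕ i) ≢ t (toℕ j) × adj G (t (toℕ i)) (t (toℕ j)) ≡ adj H i j)
  Sat-pairClause t i j with toℕ i <ᵇ toℕ j in i<ᵇj | adj H i j
  ... | false | _ = mk⇔ (λ _ i<j → ⊥-elim (subst T i<ᵇj (<⇒<ᵇ i<j))) (λ _ → tt)
  ... | true | true =
    mk⇔ (λ (ne , sat) _ → ne , to (defines t ne) sat)
        (λ ind → case ind i<j of λ (ne , e) → ne , from (defines t ne) e)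
    where
    i<j : i <ᶠ j
    i<j = <ᵇ⇒< _ _ (subst T (sym i<ᵇj) tt)
  ... | true | false =
    mk⇔ (λ (ne , ¬sat) _ → ne , ¬-not (¬sat ∘ from (defines t ne)))
        (λ ind → case ind i<j of λ (ne , ¬e) →
                 ne , λ sat → contradiction (trans (sym ¬e) (to (defines t ne) sat)) λ ())
    where
    i<j : i <ᶠ j
    i<j = <ᵇ⇒< _ _ (subst T (sym i<ᵇj) tt)

  Sat-matrix⇔increasing : ∀ t →
    Sat 𝔄 (⋀Fin (n H) λ i → ⋀Fin (n H) λ j →
             pairClause ε (toℕ i <ᵇ toℕ j) (adj H i j) (toℕ i) (toℕ j)) t ⇔
    InducedOnIncreasingPairs G H (t ∘ toℕ)
  Sat-matrix⇔increasing t = mk⇔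
    (λ sat i j → to (Sat-pairClause t i j) (Sat-⋀Fin⁻ 𝔄 _ _ t (Sat-⋀Fin⁻ 𝔄 _ _ t sat i) j))
    (λ ind → Sat-⋀Fin⁺ 𝔄 _ _ t λ i → Sat-⋀Fin⁺ 𝔄 _ _ t λ j → from (Sat-pairClause t i j) (ind i j))

  containsInduced⇔⊨inducedBy : ContainsInduced G H ⇔ 𝔄 ⊨ inducedBy ε H
  containsInduced⇔⊨inducedBy = mk⇔ satisfy extract
    where
    satisfy : ContainsInduced G H → 𝔄 ⊨ inducedBy ε H
    satisfy (f , f-emb) s =
      Sat-∃Prefix⁺ 𝔄 (n H) _ s (extend f s) (extend-≥ f s)
        (from (Sat-matrix⇔increasing (extend f s))
          (from (increasing⇔embedding G H _)
            (IsInducedEmbedding-cong G H (sym ∘ extend-toℕ f s) f-emb)))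

    -- Evaluating a sentence needs some assignment, which exists as V(G) ≠ ∅.
    extract : 𝔄 ⊨ inducedBy ε H → ContainsInduced G H
    extract sat with Sat-∃Prefix⁻ 𝔄 (n H) _ _ (sat λ _ → fromℕ< (nonempty G))
    ... | t , sat-t = t ∘ toℕ , to (increasing⇔embedding G H _) (to (Sat-matrix⇔increasing t) sat-t)

⋀Fin-cong : ∀ {b} k {f g : Fin k → Formula b} → (∀ i → f i ≡ g i) → ⋀Fin k f ≡ ⋀Fin k g
⋀Fin-cong zero    f≗g = refl
⋀Fin-cong (suc k) f≗g = cong₂ _∧'_ (f≗g zero) (⋀Fin-cong k (f≗g ∘ suc))

-- The clauses of induced² are built by a function local to its definition,
-- which cannot be referred to; unification names them through refl.
induced²-matrix : (b : ℕ) (H : Graph) →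
  Σ (Fin (n H) → Fin (n H) → Formula b) λ clause →
    induced² b H ≡ ∃Prefix (n H) (⋀Fin (n H) λ i → ⋀Fin (n H) (clause i))
induced²-matrix b H = _ , refl

induced²≡inducedBy : ∀ b H → induced² b H ≡ inducedBy (edge² b) H
induced²≡inducedBy b H =
  trans (proj₂ (induced²-matrix b H))
        (cong (∃Prefix (n H)) (⋀Fin-cong (n H) λ i → ⋀Fin-cong (n H) (clause≡ i)))
  where
  clause≡ : ∀ i j → proj₁ (induced²-matrix b H) i j ≡
                    pairClause (edge² b) (toℕ i <ᵇ toℕ j) (adj H i j) (toℕ i) (toℕ j)
  clause≡ i j with toℕ i <ᵇ toℕ j | adj H i j
  ... | false | _     = refl
  ... | true  | true  = refl
  ... | true  | false = refl

lemma4p13 : (d b : ℕ) (G : Graph) (V₁ V₂ : Subset (n G))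
            (enum : Fin b → Fin (n G)) → IsBridge d b G V₁ V₂ enum →
            (H : Graph) →
            ContainsInduced G H ⇔ (𝒟 G V₁ V₂ enum d ⊨ induced² b H)
lemma4p13 d b G V₁ V₂ enum bridge H =
  subst (λ φ → ContainsInduced G H ⇔ (𝔇 ⊨ φ)) (sym (induced²≡inducedBy b H))
        (containsInduced⇔⊨inducedBy G (unRel 𝔇) (R 𝔇) (edge²-defines-adjacency bridge) H)
  where
  𝔇 : Structure b
  𝔇 = 𝒟 G V₁ V₂ enum d
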